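{- There is a 2-factorization of the complete graph $K_{21}$ consisting of exactly $8$ $C_3$-factors and $2$ $C_7$-factors.
   Context: A $C_k$-factor of a graph $G$ is a spanning subgraph of $G$ each of whose components is a cycle of length $k$. A 2-factorization of $G$ is a partition of the edge set of $G$ into spanning 2-regular subgraphs (2-factors). -}

module Defs where

open import Data.Nat using (ℕ; zero; suc)
open import Data.Fin using (Fin; zero; suc; inject₁; fromℕ)
open import Data.Vec using (Vec; lookup)
open import Data.Product using (Σ; _×_; ∃; _,_)
open import Data.Sum using (_⊎_)
open import Data.Empty using (⊥)
open import Relation.Binary.PropositionalEquality using (_≡_)
open import Relation.Nullary using (¬_)

ExactlyOne : (A : Set) → (A → Set) → Set
ExactlyOne A P = Σ A P × (∀ a b → P a → P b → a ≡ b)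

CycleEdge : {n k : ℕ} → Vec (Fin n) k → Fin n → Fin n → Set
CycleEdge {n} {zero} c u v = ⊥
CycleEdge {n} {suc k} c u v =
  (∃ λ (i : Fin k) →
      (lookup c (inject₁ i) ≡ u × lookup c (suc i) ≡ v)
    ⊎ (lookup c (inject₁ i) ≡ v × lookup c (suc i) ≡ u))
  ⊎ ((lookup c (fromℕ k) ≡ u × lookup c zero ≡ v)
    ⊎ (lookup c (fromℕ k) ≡ v × lookup c zero ≡ u))

-- A C_k-factor of K_n (vertex set Fin n): a family of k-cycles, each given by its
-- cyclic vertex sequence, such that every vertex of K_n occurs exactly once
-- among all positions of all cycles (so the cycles have distinct vertices, are
-- pairwise vertex-disjoint, and together span all vertices).
record CkFactor (n k : ℕ) : Set where
  field
    numCycles : ℕ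
    cycles    : Vec (Vec (Fin n) k) numCycles
    spanning  : ∀ (v : Fin n) →
                ExactlyOne (Fin numCycles × Fin k)
                  (λ { (i , j) → lookup (lookup cycles i) j ≡ v })

FactorEdge : {n k : ℕ} → CkFactor n k → Fin n → Fin n → Set
FactorEdge F u v = ∃ λ i → CycleEdge (lookup (CkFactor.cycles F) i) u v

record Factorization (n p a q b : ℕ) : Set where
  field
    factorsA : Fin p → CkFactor n a
    factorsB : Fin q → CkFactor n b
    partition : ∀ (u v : Fin n) → ¬ (u ≡ v) →
      ExactlyOne (Fin p ⊎ Fin q)
        (λ { (Data.Sum.inj₁ j) → FactorEdge (factorsA j) u v
           ; (Data.Sum.inj₂ j) → FactorEdge (factorsB j) u v })

-- Take the vertex set to be {0, 1, 2} × ℤ₇. An edge inside a level has a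
-- difference in {1, 2, 3}, an edge between two levels a difference in ℤ₇, and
-- each of these difference classes consists of 7 edges permuted cyclically by the
-- translation x ↦ x + 1. The vertical triangles {(0,x), (1,x), (2,x)} form a
-- C₃-factor using cross difference 0. A base C₃-factor using every nonzero cross
-- difference once and one difference inside each level has seven translates,
-- which cover these classes. The two differences left on each level are the steps
-- of circulant 7-cycles, and these 7-cycles make up the two C₇-factors.
module Submission where

open import Data.Fin using (Fin; _<_; zero; suc; inject₁; fromℕ; toℕ; combine; #_)
open import Data.Fin.Properties using (_<?_; <-cmp) renaming (_≟_ to _≟ᶠ_; all? to allFin?; any? to anyFin?)
open import Data.Nat using (ℕ; zero; suc; _+_; _*_)
open import Data.Nat.DivMod using (_mod_)
open import Data.Product using (_×_; ∃; _,_; uncurry; map₂)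
open import Data.Product.Properties using () renaming (≡-dec to ×-≡-dec)
open import Data.Sum using (_⊎_; inj₁; inj₂; [_,_]; swap) renaming (map to map-⊎)
open import Data.Unit using (⊤; tt)
open import Data.Empty using (⊥-elim)
open import Data.Sum.Properties using () renaming (≡-dec to ⊎-≡-dec)
open import Data.Sum.Relation.Binary.LeftOrder using (_⊎-<_; ⊎-<-decidable; ⊎-<-trichotomous)
open import Data.Sum.Relation.Binary.Pointwise using (Pointwise-≡⇒≡)
open import Data.Vec using (Vec; []; _∷_; lookup; tabulate; map)
open import Function using (_∘_)
open import Relation.Binary.Definitions using (DecidableEquality; Symmetric; tri<; tri≈; tri>) renaming (Decidable to Decidable₂)
open import Relation.Binary.PropositionalEquality using (_≡_; refl)
open import Relation.Nullary using (¬_; Dec; yes; no; ¬?)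
open import Relation.Nullary.Decidable using (toWitness; map′; _×-dec_; _⊎-dec_; _→-dec_)
open import Relation.Unary using (Decidable)

open import Defs

record Searchable (A : Set) : Set₁ where
  field
    _≟_  : DecidableEquality A
    all? : {Q : A → Set} → Decidable Q → Dec (∀ a → Q a)
    any? : {Q : A → Set} → Decidable Q → Dec (∃ Q)

fin-searchable : {n : ℕ} → Searchable (Fin n)
fin-searchable = record { _≟_ = _≟ᶠ_ ; all? = allFin? ; any? = anyFin? }

module _ {A B : Set} (SA : Searchable A) (SB : Searchable B) where
  private
    module SA = Searchable SA
    module SB = Searchable SB

  ×-searchable : Searchable (A × B)
  ×-searchable = record
    { _≟_  = ×-≡-dec SA._≟_ SB._≟_
    ; all? = λ Q? → map′ uncurry (λ h a b → h (a , b))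
                      (SA.all? λ a → SB.all? λ b → Q? (a , b))
    ; any? = λ Q? → map′ (λ (a , b , q) → (a , b) , q) (λ ((a , b) , q) → a , b , q)
                      (SA.any? λ a → SB.any? λ b → Q? (a , b))
    }

  ⊎-searchable : Searchable (A ⊎ B)
  ⊎-searchable = record
    { _≟_  = ⊎-≡-dec SA._≟_ SB._≟_
    ; all? = λ Q? → map′ (λ (f , g) → [ f , g ]) (λ h → h ∘ inj₁ , h ∘ inj₂)
                      (SA.all? (Q? ∘ inj₁) ×-dec SB.all? (Q? ∘ inj₂))
    ; any? = λ Q? → map′ [ (λ (a , q) → inj₁ a , q) , (λ (b , q) → inj₂ b , q) ]
                         (λ { (inj₁ a , q) → inj₁ (a , q) ; (inj₂ b , q) → inj₂ (b , q) })
                      (SA.any? (Q? ∘ inj₁) ⊎-dec SB.any? (Q? ∘ inj₂))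
    }

exactlyOne? : {A : Set} → Searchable A → {P : A → Set} → Decidable P → Dec (ExactlyOne A P)
exactlyOne? S P? =
  any? P? ×-dec map′ (λ h a b pa pb → h a pa b pb) (λ h a pa b pb → h a b pa pb)
                  (all? λ a → P? a →-dec all? λ b → P? b →-dec a ≟ b)
  where open Searchable S

ExactlyOne-cong : {A : Set} {P Q : A → Set} → (∀ {a} → P a → Q a) → (∀ {a} → Q a → P a) →
                  ExactlyOne A P → ExactlyOne A Q
ExactlyOne-cong P⇒Q Q⇒P ((a , pa) , unique) =
  (a , P⇒Q pa) , λ a b qa qb → unique a b (Q⇒P qa) (Q⇒P qb)

cycleEdge? : {n k : ℕ} (c : Vec (Fin n) k) (u v : Fin n) → Dec (CycleEdge c u v)
cycleEdge? {k = zero} c u v = no (λ ())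
cycleEdge? {k = suc k} c u v =
  anyFin? (λ i → edge? (lookup c (inject₁ i)) (lookup c (suc i)))
  ⊎-dec edge? (lookup c (fromℕ k)) (lookup c zero)
  where
  edge? : (x y : Fin _) → Dec ((x ≡ u × y ≡ v) ⊎ (x ≡ v × y ≡ u))
  edge? x y = ((x ≟ᶠ u) ×-dec (y ≟ᶠ v)) ⊎-dec ((x ≟ᶠ v) ×-dec (y ≟ᶠ u))

cycleEdge-sym : {n k : ℕ} {c : Vec (Fin n) k} {u v : Fin n} → CycleEdge c u v → CycleEdge c v u
cycleEdge-sym {k = suc k} = map-⊎ (map₂ swap) swap

factorEdge? : {n k : ℕ} (F : CkFactor n k) (u v : Fin n) → Dec (FactorEdge F u v)
factorEdge? F u v = anyFin? λ i → cycleEdge? (lookup (CkFactor.cycles F) i) u v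

factorEdge-sym : {n k : ℕ} {F : CkFactor n k} {u v : Fin n} → FactorEdge F u v → FactorEdge F v u
factorEdge-sym = map₂ cycleEdge-sym

AllCycleEdges : {n k : ℕ} → (Fin n → Fin n → Set) → Vec (Fin n) k → Set
AllCycleEdges {k = zero}  R c = ⊤
AllCycleEdges {k = suc k} R c =
  (∀ i → R (lookup c (inject₁ i)) (lookup c (suc i))) × R (lookup c (fromℕ k)) (lookup c zero)

allCycleEdges? : {n k : ℕ} {R : Fin n → Fin n → Set} → Decidable₂ R →
                 (c : Vec (Fin n) k) → Dec (AllCycleEdges R c)
allCycleEdges? {k = zero}  R? c = yes tt
allCycleEdges? {k = suc k} R? c =
  allFin? (λ i → R? (lookup c (inject₁ i)) (lookup c (suc i))) ×-dec R? (lookup c (fromℕ k)) (lookup c zero)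

lookupCycleEdge : {n k : ℕ} {R : Fin n → Fin n → Set} {c : Vec (Fin n) k} {u v : Fin n} →
                  Symmetric R → AllCycleEdges R c → CycleEdge c u v → R u v
lookupCycleEdge {k = suc k} R-sym (all , last) (inj₁ (i , inj₁ (refl , refl))) = all i
lookupCycleEdge {k = suc k} R-sym (all , last) (inj₁ (i , inj₂ (refl , refl))) = R-sym (all i)
lookupCycleEdge {k = suc k} R-sym (all , last) (inj₂ (inj₁ (refl , refl)))     = last
lookupCycleEdge {k = suc k} R-sym (all , last) (inj₂ (inj₂ (refl , refl)))     = R-sym last

AllFactorEdges : {n k : ℕ} → (Fin n → Fin n → Set) → CkFactor n k → Set
AllFactorEdges R F = ∀ i → AllCycleEdges R (lookup (CkFactor.cycles F) i)

allFactorEdges? : {n k : ℕ} {R : Fin n → Fin n → Set} → Decidable₂ R →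
                  (F : CkFactor n k) → Dec (AllFactorEdges R F)
allFactorEdges? R? F = allFin? λ i → allCycleEdges? R? (lookup (CkFactor.cycles F) i)

lookupFactorEdge : {n k : ℕ} {R : Fin n → Fin n → Set} (F : CkFactor n k) {u v : Fin n} →
                   Symmetric R → AllFactorEdges R F → FactorEdge F u v → R u v
lookupFactorEdge F R-sym all (i , e) = lookupCycleEdge R-sym (all i) e

Spanning : {n m k : ℕ} → Vec (Vec (Fin n) k) m → Set
Spanning {n} {m} {k} cs = ∀ v → ExactlyOne (Fin m × Fin k) (λ (i , j) → lookup (lookup cs i) j ≡ v)

spanning? : {n m k : ℕ} (cs : Vec (Vec (Fin n) k) m) → Dec (Spanning cs)
spanning? cs = allFin? λ v →
  exactlyOne? (×-searchable fin-searchable fin-searchable) λ (i , j) → lookup (lookup cs i) j ≟ᶠ v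

ckFactor : {n m k : ℕ} (cs : Vec (Vec (Fin n) k) m) → Spanning cs → CkFactor n k
ckFactor cs spans = record { cycles = cs ; spanning = spans }

module _ {n p a q b : ℕ} (factorsA : Fin p → CkFactor n a) (factorsB : Fin q → CkFactor n b) where

  private
    colours : Searchable (Fin p ⊎ Fin q)
    colours = ⊎-searchable fin-searchable fin-searchable
    open Searchable colours using (all?; any?)

  InFactor : Fin p ⊎ Fin q → Fin n → Fin n → Set
  InFactor (inj₁ j) = FactorEdge (factorsA j)
  InFactor (inj₂ j) = FactorEdge (factorsB j)

  inFactor? : ∀ c u v → Dec (InFactor c u v)
  inFactor? (inj₁ j) = factorEdge? (factorsA j)
  inFactor? (inj₂ j) = factorEdge? (factorsB j)

  inFactor-sym : ∀ c {u v} → InFactor c u v → InFactor c v u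
  inFactor-sym (inj₁ j) = factorEdge-sym {F = factorsA j}
  inFactor-sym (inj₂ j) = factorEdge-sym {F = factorsB j}

  Covering : Set
  Covering = ∀ u v → ¬ u ≡ v → ∃ λ c → InFactor c u v

  CoveringUpward : Set
  CoveringUpward = ∀ u v → u < v → ∃ λ c → InFactor c u v

  coveringUpward? : Dec CoveringUpward
  coveringUpward? = allFin? λ u → allFin? λ v → (u <? v) →-dec any? λ c → inFactor? c u v

  covering : CoveringUpward → Covering
  covering upward u v u≢v with <-cmp u v
  ... | tri< u<v _ _ = upward u v u<v
  ... | tri≈ _ u≡v _ = ⊥-elim (u≢v u≡v)
  ... | tri> _ _ v<u = map₂ (λ {c} → inFactor-sym c) (upward v u v<u)

  _<ᶜ_ : Fin p ⊎ Fin q → Fin p ⊎ Fin q → Set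
  _<ᶜ_ = _<_ ⊎-< _<_

  -- Testing each edge only against later factors halves the search; uniqueness
  -- then follows by trichotomy.
  AbsentAfter : Fin p ⊎ Fin q → Fin n → Fin n → Set
  AbsentAfter c u v = ∀ c′ → c <ᶜ c′ → ¬ InFactor c′ u v

  absentAfter? : ∀ c → Decidable₂ (AbsentAfter c)
  absentAfter? c u v = all? λ c′ → ⊎-<-decidable _<?_ _<?_ c c′ →-dec ¬? (inFactor? c′ u v)

  absentAfter-sym : ∀ c → Symmetric (AbsentAfter c)
  absentAfter-sym c absent c′ c<c′ = absent c′ c<c′ ∘ inFactor-sym c′

  EdgesAbsentAfter : Set
  EdgesAbsentAfter = (∀ j → AllFactorEdges (AbsentAfter (inj₁ j)) (factorsA j))
                   × (∀ j → AllFactorEdges (AbsentAfter (inj₂ j)) (factorsB j))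

  edgesAbsentAfter? : Dec EdgesAbsentAfter
  edgesAbsentAfter? = allFin? (λ j → allFactorEdges? (absentAfter? (inj₁ j)) (factorsA j))
                ×-dec allFin? (λ j → allFactorEdges? (absentAfter? (inj₂ j)) (factorsB j))

  absentAfter : EdgesAbsentAfter → ∀ c {u v} → InFactor c u v → AbsentAfter c u v
  absentAfter (absentA , _) (inj₁ j) = lookupFactorEdge (factorsA j) (absentAfter-sym (inj₁ j)) (absentA j)
  absentAfter (_ , absentB) (inj₂ j) = lookupFactorEdge (factorsB j) (absentAfter-sym (inj₂ j)) (absentB j)

  factorization : Covering → EdgesAbsentAfter → Factorization n p a q b
  factorization covers absent = record
    { factorsA = factorsA
    ; factorsB = factorsB
    -- The predicate in Factorization is its own pattern lambda, equal to
    -- InFactor only after case analysis on the colour.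
    ; partition = λ u v u≢v → ExactlyOne-cong
        (λ { {inj₁ j} e → e ; {inj₂ j} e → e })
        (λ { {inj₁ j} e → e ; {inj₂ j} e → e })
        (covers u v u≢v , unique)
    }
    where
    unique : ∀ {u v} c c′ → InFactor c u v → InFactor c′ u v → c ≡ c′
    unique c c′ in-c in-c′ with ⊎-<-trichotomous <-cmp <-cmp c c′
    ... | tri< c<c′ _ _ = ⊥-elim (absentAfter absent c in-c c′ c<c′ in-c′)
    ... | tri≈ _ c≈c′ _ = Pointwise-≡⇒≡ c≈c′
    ... | tri> _ _ c′<c = ⊥-elim (absentAfter absent c′ in-c′ c c′<c in-c)

-- The vertex (t, x) of ℤ₇ × {0, 1, 2} is 7t + (x mod 7).
point : Fin 3 → ℕ → Fin 21
point t x = combine t (x mod 7)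

baseTriangles : Vec (Vec (Fin 3 × ℕ) 3) 7
baseTriangles =
  ((# 0 , 1) ∷ (# 0 , 2) ∷ (# 1 , 0) ∷ []) ∷
  ((# 0 , 3) ∷ (# 1 , 5) ∷ (# 2 , 2) ∷ []) ∷
  ((# 0 , 4) ∷ (# 2 , 1) ∷ (# 2 , 5) ∷ []) ∷
  ((# 1 , 1) ∷ (# 1 , 3) ∷ (# 2 , 6) ∷ []) ∷
  ((# 0 , 6) ∷ (# 1 , 2) ∷ (# 2 , 4) ∷ []) ∷
  ((# 0 , 0) ∷ (# 1 , 4) ∷ (# 2 , 3) ∷ []) ∷
  ((# 0 , 5) ∷ (# 1 , 6) ∷ (# 2 , 0) ∷ []) ∷ []

triangles : Fin 8 → Vec (Vec (Fin 21) 3) 7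
triangles zero    = tabulate λ x → tabulate λ t → point t (toℕ x)
triangles (suc s) = map (map λ (t , x) → point t (x + toℕ s)) baseTriangles

heptagonSteps : Fin 2 → Vec ℕ 3
heptagonSteps zero       = 2 ∷ 1 ∷ 1 ∷ []
heptagonSteps (suc zero) = 3 ∷ 3 ∷ 2 ∷ []

heptagons : Fin 2 → Vec (Vec (Fin 21) 7) 3
heptagons j = tabulate λ t → tabulate λ i → point t (toℕ i * lookup (heptagonSteps j) t)

triangles-spanning : ∀ j → Spanning (triangles j)
triangles-spanning = toWitness {a? = allFin? (spanning? ∘ triangles)} _

heptagons-spanning : ∀ j → Spanning (heptagons j)
heptagons-spanning = toWitness {a? = allFin? (spanning? ∘ heptagons)} _

triangleFactor : Fin 8 → CkFactor 21 3
triangleFactor j = ckFactor (triangles j) (triangles-spanning j)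

heptagonFactor : Fin 2 → CkFactor 21 7
heptagonFactor j = ckFactor (heptagons j) (heptagons-spanning j)

factors-covering : Covering triangleFactor heptagonFactor
factors-covering = covering triangleFactor heptagonFactor
  (toWitness {a? = coveringUpward? triangleFactor heptagonFactor} _)

factors-edgesAbsentAfter : EdgesAbsentAfter triangleFactor heptagonFactor
factors-edgesAbsentAfter = toWitness {a? = edgesAbsentAfter? triangleFactor heptagonFactor} _

lemma3p2 : Factorization 21 8 3 2 7
lemma3p2 = factorization triangleFactor heptagonFactor factors-covering factors-edgesAbsentAfter
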